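{- For every MALL formula $A$, $[\![A^\perp]\!]_C=_{\mathcal{D}}[\![A]\!]_C\multimap\bot$. For every formula $F$ of the categorical language, $[\![[\![F]\!]_M]\!]_C=_{\mathcal{D}}F$. For all MALL formulas $A,B$, if $A=_{\mathcal{E}}B$ then $[\![A]\!]_C=_{\mathcal{D}}[\![B]\!]_C$.
   Context: MALL formulas: $A::=X\mid X^\perp\mid A\otimes A\mid A⅋A\mid1\mid\bot\mid A\&A\mid A\oplus A\mid\top\mid0$ with De Morgan negation ($(A\otimes B)^\perp=B^\perp⅋A^\perp$, $(A\&B)^\perp=B^\perp\oplus A^\perp$, $1^\perp=\bot$, $\top^\perp=0$, involutive). Categorical language: $F::=X\mid F\otimes F\mid1\mid F\multimap F\mid\bot\mid F\&F\mid\top$. Translation $[\![\cdot]\!]_M$ to MALL: identity on atoms, $\otimes,1,\bot,\&,\top$, and $[\![F\multimap G]\!]_M=[\![F]\!]_M^\perp⅋[\![G]\!]_M$. Translation $[\![\cdot]\!]_C$ to the categorical language: $[\![X]\!]_C=X$, $[\![X^\perp]\!]_C=X\multimap\bot$, $[\![A\otimes B]\!]_C=[\![A]\!]_C\otimes[\![B]\!]_C$, $[\![1]\!]_C=1$, $[\![A⅋B]\!]_C=(([\![A]\!]_C\multimap\bot)\otimes([\![B]\!]_C\multimap\bot))\multimap\bot$, $[\![\bot]\!]_C=\bot$, $[\![A\&B]\!]_C=[\![A]\!]_C\&[\![B]\!]_C$, $[\![\top]\!]_C=\top$, $[\![A\oplus B]\!]_C=(([\![A]\!]_C\multimap\bot)\&([\![B]\!]_C\multimap\bot))\multimap\bot$,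 $[\![0]\!]_C=\top\multimap\bot$. $\mathcal{D}$ is the congruence on categorical formulas generated by: $F\otimes(G\otimes H)=(F\otimes G)\otimes H$; $F\otimes G=G\otimes F$; $F\otimes1=F$; $(F\otimes G)\multimap H=F\multimap(G\multimap H)$; $1\multimap F=F$; $F\&(G\&H)=(F\&G)\&H$; $F\&G=G\&F$; $F\&\top=F$; $F\multimap(G\&H)=(F\multimap G)\&(F\multimap H)$; $F\multimap\top=\top$; $(F\multimap\bot)\multimap\bot=F$. $\mathcal{E}$ is the congruence on MALL formulas generated by associativity and commutativity of $\otimes,⅋,\oplus,\&$; $A\otimes(B\oplus C)=(A\otimes B)\oplus(A\otimes C)$; $A⅋(B\&C)=(A⅋B)\&(A⅋C)$; $A\otimes1=A$; $A⅋\bot=A$; $A\oplus0=A$; $A\&\top=A$; $A\otimes0=0$; $A⅋\top=\top$. -}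

module Defs where

open import Data.Product using (_×_; _,_)

module Formulas (Atom : Set) where

  infixr 6 _⊗_ _⅋_
  infixr 5 _&_ _⊕_
  infixr 4 _⊸_

  -- MALL formulas (negation normal form)
  data MALL : Set where
    pos  : Atom → MALL
    neg  : Atom → MALL
    _⊗_  : MALL → MALL → MALL
    _⅋_  : MALL → MALL → MALL
    𝟙    : MALL
    ⊥'   : MALL
    _&_  : MALL → MALL → MALL
    _⊕_  : MALL → MALL → MALL
    ⊤'   : MALL
    𝟘    : MALL

  _^⊥ : MALL → MALL
  pos x ^⊥   = neg x
  neg x ^⊥   = pos x
  (A ⊗ B) ^⊥ = (B ^⊥) ⅋ (A ^⊥)
  (A ⅋ B) ^⊥ = (B ^⊥) ⊗ (A ^⊥)
  𝟙 ^⊥       = ⊥'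
  ⊥' ^⊥      = 𝟙
  (A & B) ^⊥ = (B ^⊥) ⊕ (A ^⊥)
  (A ⊕ B) ^⊥ = (B ^⊥) & (A ^⊥)
  ⊤' ^⊥      = 𝟘
  𝟘 ^⊥       = ⊤'

  data Cat : Set where
    atom : Atom → Cat
    _⊗_  : Cat → Cat → Cat
    I    : Cat
    _⊸_  : Cat → Cat → Cat
    ⊥    : Cat
    _&_  : Cat → Cat → Cat
    ⊤    : Cat

  ⟦_⟧M : Cat → MALL
  ⟦ atom x ⟧M = pos x
  ⟦ F ⊗ G ⟧M  = ⟦ F ⟧M ⊗ ⟦ G ⟧M
  ⟦ I ⟧M      = 𝟙
  ⟦ F ⊸ G ⟧M  = (⟦ F ⟧M ^⊥) ⅋ ⟦ G ⟧M
  ⟦ ⊥ ⟧M      = ⊥'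
  ⟦ F & G ⟧M  = ⟦ F ⟧M & ⟦ G ⟧M
  ⟦ ⊤ ⟧M      = ⊤'

  ⟦_⟧C : MALL → Cat
  ⟦ pos x ⟧C = atom x
  ⟦ neg x ⟧C = atom x ⊸ ⊥
  ⟦ A ⊗ B ⟧C = ⟦ A ⟧C ⊗ ⟦ B ⟧C
  ⟦ 𝟙 ⟧C     = I
  ⟦ A ⅋ B ⟧C = ((⟦ A ⟧C ⊸ ⊥) ⊗ (⟦ B ⟧C ⊸ ⊥)) ⊸ ⊥
  ⟦ ⊥' ⟧C    = ⊥
  ⟦ A & B ⟧C = ⟦ A ⟧C & ⟦ B ⟧C
  ⟦ ⊤' ⟧C    = ⊤
  ⟦ A ⊕ B ⟧C = ((⟦ A ⟧C ⊸ ⊥) & (⟦ B ⟧C ⊸ ⊥)) ⊸ ⊥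
  ⟦ 𝟘 ⟧C     = ⊤ ⊸ ⊥

  infix 3 _=D_
  data _=D_ : Cat → Cat → Set where
    refl  : ∀ {F} → F =D F
    sym   : ∀ {F G} → F =D G → G =D F
    trans : ∀ {F G H} → F =D G → G =D H → F =D H
    ⊗-cong : ∀ {F F' G G'} → F =D F' → G =D G' → F ⊗ G =D F' ⊗ G'
    ⊸-cong : ∀ {F F' G G'} → F =D F' → G =D G' → F ⊸ G =D F' ⊸ G'
    &-cong : ∀ {F F' G G'} → F =D F' → G =D G' → F & G =D F' & G'
    ⊗-assoc : ∀ {F G H} → F ⊗ (G ⊗ H) =D (F ⊗ G) ⊗ H
    ⊗-comm  : ∀ {F G} → F ⊗ G =D G ⊗ F
    ⊗-unit  : ∀ {F} → F ⊗ I =D F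
    curry   : ∀ {F G H} → (F ⊗ G) ⊸ H =D F ⊸ (G ⊸ H)
    ⊸-unit  : ∀ {F} → I ⊸ F =D F
    &-assoc : ∀ {F G H} → F & (G & H) =D (F & G) & H
    &-comm  : ∀ {F G} → F & G =D G & F
    &-unit  : ∀ {F} → F & ⊤ =D F
    ⊸-&     : ∀ {F G H} → F ⊸ (G & H) =D (F ⊸ G) & (F ⊸ H)
    ⊸-⊤     : ∀ {F} → F ⊸ ⊤ =D ⊤
    dn      : ∀ {F} → (F ⊸ ⊥) ⊸ ⊥ =D F

  infix 3 _=E_
  data _=E_ : MALL → MALL → Set where
    refl  : ∀ {A} → A =E A
    sym   : ∀ {A B} → A =E B → B =E A
    trans : ∀ {A B C} → A =E B → B =E C → A =E C
    ⊗-cong : ∀ {A A' B B'} → A =E A' → B =E B' → A ⊗ B =E A' ⊗ B'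
    ⅋-cong : ∀ {A A' B B'} → A =E A' → B =E B' → A ⅋ B =E A' ⅋ B'
    &-cong : ∀ {A A' B B'} → A =E A' → B =E B' → A & B =E A' & B'
    ⊕-cong : ∀ {A A' B B'} → A =E A' → B =E B' → A ⊕ B =E A' ⊕ B'
    ⊗-assoc : ∀ {A B C} → A ⊗ (B ⊗ C) =E (A ⊗ B) ⊗ C
    ⊗-comm  : ∀ {A B} → A ⊗ B =E B ⊗ A
    ⅋-assoc : ∀ {A B C} → A ⅋ (B ⅋ C) =E (A ⅋ B) ⅋ C
    ⅋-comm  : ∀ {A B} → A ⅋ B =E B ⅋ A
    ⊕-assoc : ∀ {A B C} → A ⊕ (B ⊕ C) =E (A ⊕ B) ⊕ C
    ⊕-comm  : ∀ {A B} → A ⊕ B =E B ⊕ A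
    &-assoc : ∀ {A B C} → A & (B & C) =E (A & B) & C
    &-comm  : ∀ {A B} → A & B =E B & A
    ⊗-⊕     : ∀ {A B C} → A ⊗ (B ⊕ C) =E (A ⊗ B) ⊕ (A ⊗ C)
    ⅋-&     : ∀ {A B C} → A ⅋ (B & C) =E (A ⅋ B) & (A ⅋ C)
    ⊗-unit  : ∀ {A} → A ⊗ 𝟙 =E A
    ⅋-unit  : ∀ {A} → A ⅋ ⊥' =E A
    ⊕-unit  : ∀ {A} → A ⊕ 𝟘 =E A
    &-unit  : ∀ {A} → A & ⊤' =E A
    ⊗-zero  : ∀ {A} → A ⊗ 𝟘 =E 𝟘
    ⅋-top   : ∀ {A} → A ⅋ ⊤' =E ⊤'

-- MALL connectives are interpreted in the categorical language through the
-- linear negation ¬ F = F ⊸ ⊥: a ⅋ b and a ⊕ b become the De Morgan duals of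
-- ⊗ and &.  Because D makes ¬ involutive and lets ⊸ curry ⊗ and distribute
-- over &, these derived connectives satisfy every law of E, and the
-- translation sends De Morgan negation to ¬.
module Submission where

open import Defs
open import Data.Product using (_×_; _,_)
open import Relation.Binary.Bundles using (Setoid)
import Relation.Binary.Reasoning.Setoid as SetoidReasoning

module _ (Atom : Set) where
  open Defs.Formulas Atom

  =D-setoid : Setoid _ _
  =D-setoid = record
    { Carrier       = Cat
    ; _≈_           = _=D_
    ; isEquivalence = record { refl = refl ; sym = sym ; trans = trans }
    }

  open SetoidReasoning =D-setoid

  infix  7 ¬_
  infixr 6 _⅋ᶜ_
  infixr 5 _⊕ᶜ_

  ¬_ : Cat → Cat
  ¬ F = F ⊸ ⊥

  _⅋ᶜ_ : Cat → Cat → Cat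
  F ⅋ᶜ G = ¬ (¬ F ⊗ ¬ G)

  _⊕ᶜ_ : Cat → Cat → Cat
  F ⊕ᶜ G = ¬ (¬ F & ¬ G)

  ¬-cong : ∀ {F G} → F =D G → ¬ F =D ¬ G
  ¬-cong p = ⊸-cong p refl

  ¬-⊗ : ∀ {F G} → ¬ (F ⊗ G) =D F ⊸ ¬ G
  ¬-⊗ = curry

  ¬⊥ : ¬ ⊥ =D I
  ¬⊥ = trans (¬-cong (sym ⊸-unit)) dn

  ⊗-¬ : ∀ {F G} → F ⊗ ¬ G =D ¬ (F ⊸ G)
  ⊗-¬ {F} {G} = begin
    F ⊗ ¬ G        ≈⟨ sym dn ⟩
    ¬ ¬ (F ⊗ ¬ G)  ≈⟨ ¬-cong ¬-⊗ ⟩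
    ¬ (F ⊸ ¬ ¬ G)  ≈⟨ ¬-cong (⊸-cong refl dn) ⟩
    ¬ (F ⊸ G)      ∎

  ⅋ᶜ-cong : ∀ {F F' G G'} → F =D F' → G =D G' → F ⅋ᶜ G =D F' ⅋ᶜ G'
  ⅋ᶜ-cong p q = ¬-cong (⊗-cong (¬-cong p) (¬-cong q))

  ⊕ᶜ-cong : ∀ {F F' G G'} → F =D F' → G =D G' → F ⊕ᶜ G =D F' ⊕ᶜ G'
  ⊕ᶜ-cong p q = ¬-cong (&-cong (¬-cong p) (¬-cong q))

  ⅋ᶜ≈⊸ : ∀ {F G} → F ⅋ᶜ G =D ¬ F ⊸ G
  ⅋ᶜ≈⊸ = trans ¬-⊗ (⊸-cong refl dn)

  ¬⅋ᶜ¬ : ∀ {F G} → ¬ F ⅋ᶜ ¬ G =D ¬ (F ⊗ G)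
  ¬⅋ᶜ¬ = ¬-cong (⊗-cong dn dn)

  ¬⊕ᶜ¬ : ∀ {F G} → ¬ F ⊕ᶜ ¬ G =D ¬ (F & G)
  ¬⊕ᶜ¬ = ¬-cong (&-cong dn dn)

  ⅋ᶜ-comm : ∀ {F G} → F ⅋ᶜ G =D G ⅋ᶜ F
  ⅋ᶜ-comm = ¬-cong ⊗-comm

  ⊕ᶜ-comm : ∀ {F G} → F ⊕ᶜ G =D G ⊕ᶜ F
  ⊕ᶜ-comm = ¬-cong &-comm

  ⅋ᶜ-assoc : ∀ {F G H} → F ⅋ᶜ (G ⅋ᶜ H) =D (F ⅋ᶜ G) ⅋ᶜ H
  ⅋ᶜ-assoc = ¬-cong (trans (⊗-cong refl dn) (trans ⊗-assoc (⊗-cong (sym dn) refl)))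

  ⊕ᶜ-assoc : ∀ {F G H} → F ⊕ᶜ (G ⊕ᶜ H) =D (F ⊕ᶜ G) ⊕ᶜ H
  ⊕ᶜ-assoc = ¬-cong (trans (&-cong refl dn) (trans &-assoc (&-cong (sym dn) refl)))

  ⅋ᶜ-unit : ∀ {F} → F ⅋ᶜ ⊥ =D F
  ⅋ᶜ-unit = trans (¬-cong (trans (⊗-cong refl ¬⊥) ⊗-unit)) dn

  ⊕ᶜ-unit : ∀ {F} → F ⊕ᶜ ¬ ⊤ =D F
  ⊕ᶜ-unit = trans (¬-cong (trans (&-cong refl dn) &-unit)) dn

  ⅋ᶜ-top : ∀ {F} → F ⅋ᶜ ⊤ =D ⊤
  ⅋ᶜ-top = trans ⅋ᶜ≈⊸ ⊸-⊤

  ⊗-¬⊤ : ∀ {F} → F ⊗ ¬ ⊤ =D ¬ ⊤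
  ⊗-¬⊤ = trans ⊗-¬ (¬-cong ⊸-⊤)

  ⅋ᶜ-distrib-& : ∀ {F G H} → F ⅋ᶜ (G & H) =D (F ⅋ᶜ G) & (F ⅋ᶜ H)
  ⅋ᶜ-distrib-& {F} {G} {H} = begin
    F ⅋ᶜ (G & H)               ≈⟨ ⅋ᶜ≈⊸ ⟩
    ¬ F ⊸ (G & H)              ≈⟨ ⊸-& ⟩
    (¬ F ⊸ G) & (¬ F ⊸ H)      ≈⟨ &-cong (sym ⅋ᶜ≈⊸) (sym ⅋ᶜ≈⊸) ⟩
    (F ⅋ᶜ G) & (F ⅋ᶜ H)        ∎

  ⊗-distrib-⊕ᶜ : ∀ {F G H} → F ⊗ (G ⊕ᶜ H) =D (F ⊗ G) ⊕ᶜ (F ⊗ H)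
  ⊗-distrib-⊕ᶜ {F} {G} {H} = begin
    F ⊗ (G ⊕ᶜ H)                   ≈⟨ ⊗-¬ ⟩
    ¬ (F ⊸ (¬ G & ¬ H))            ≈⟨ ¬-cong ⊸-& ⟩
    ¬ ((F ⊸ ¬ G) & (F ⊸ ¬ H))      ≈⟨ ¬-cong (&-cong (sym ¬-⊗) (sym ¬-⊗)) ⟩
    (F ⊗ G) ⊕ᶜ (F ⊗ H)             ∎

  ⟦⟧C-^⊥ : ∀ A → ⟦ A ^⊥ ⟧C =D ¬ ⟦ A ⟧C
  ⟦⟧C-^⊥ (pos x) = refl
  ⟦⟧C-^⊥ (neg x) = sym dn
  ⟦⟧C-^⊥ (A ⊗ B) = begin
    ⟦ B ^⊥ ⟧C ⅋ᶜ ⟦ A ^⊥ ⟧C   ≈⟨ ⅋ᶜ-cong (⟦⟧C-^⊥ B) (⟦⟧C-^⊥ A) ⟩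
    ¬ ⟦ B ⟧C ⅋ᶜ ¬ ⟦ A ⟧C     ≈⟨ ¬⅋ᶜ¬ ⟩
    ¬ (⟦ B ⟧C ⊗ ⟦ A ⟧C)      ≈⟨ ¬-cong ⊗-comm ⟩
    ¬ (⟦ A ⟧C ⊗ ⟦ B ⟧C)      ∎
  ⟦⟧C-^⊥ (A ⅋ B) = begin
    ⟦ B ^⊥ ⟧C ⊗ ⟦ A ^⊥ ⟧C    ≈⟨ ⊗-cong (⟦⟧C-^⊥ B) (⟦⟧C-^⊥ A) ⟩
    ¬ ⟦ B ⟧C ⊗ ¬ ⟦ A ⟧C      ≈⟨ ⊗-comm ⟩
    ¬ ⟦ A ⟧C ⊗ ¬ ⟦ B ⟧C      ≈⟨ sym dn ⟩
    ¬ (⟦ A ⟧C ⅋ᶜ ⟦ B ⟧C)     ∎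
  ⟦⟧C-^⊥ 𝟙       = sym ⊸-unit
  ⟦⟧C-^⊥ ⊥'      = sym ¬⊥
  ⟦⟧C-^⊥ (A & B) = begin
    ⟦ B ^⊥ ⟧C ⊕ᶜ ⟦ A ^⊥ ⟧C   ≈⟨ ⊕ᶜ-cong (⟦⟧C-^⊥ B) (⟦⟧C-^⊥ A) ⟩
    ¬ ⟦ B ⟧C ⊕ᶜ ¬ ⟦ A ⟧C     ≈⟨ ¬⊕ᶜ¬ ⟩
    ¬ (⟦ B ⟧C & ⟦ A ⟧C)      ≈⟨ ¬-cong &-comm ⟩
    ¬ (⟦ A ⟧C & ⟦ B ⟧C)      ∎
  ⟦⟧C-^⊥ (A ⊕ B) = begin
    ⟦ B ^⊥ ⟧C & ⟦ A ^⊥ ⟧C    ≈⟨ &-cong (⟦⟧C-^⊥ B) (⟦⟧C-^⊥ A) ⟩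
    ¬ ⟦ B ⟧C & ¬ ⟦ A ⟧C      ≈⟨ &-comm ⟩
    ¬ ⟦ A ⟧C & ¬ ⟦ B ⟧C      ≈⟨ sym dn ⟩
    ¬ (⟦ A ⟧C ⊕ᶜ ⟦ B ⟧C)     ∎
  ⟦⟧C-^⊥ ⊤'      = refl
  ⟦⟧C-^⊥ 𝟘       = sym dn

  ⟦⟧C∘⟦⟧M : ∀ F → ⟦ ⟦ F ⟧M ⟧C =D F
  ⟦⟧C∘⟦⟧M (atom x) = refl
  ⟦⟧C∘⟦⟧M (F ⊗ G)  = ⊗-cong (⟦⟧C∘⟦⟧M F) (⟦⟧C∘⟦⟧M G)
  ⟦⟧C∘⟦⟧M I        = refl
  ⟦⟧C∘⟦⟧M (F ⊸ G)  = begin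
    ⟦ ⟦ F ⟧M ^⊥ ⟧C ⅋ᶜ ⟦ ⟦ G ⟧M ⟧C   ≈⟨ ⅋ᶜ-cong (⟦⟧C-^⊥ ⟦ F ⟧M) (⟦⟧C∘⟦⟧M G) ⟩
    ¬ ⟦ ⟦ F ⟧M ⟧C ⅋ᶜ G              ≈⟨ ⅋ᶜ≈⊸ ⟩
    ¬ ¬ ⟦ ⟦ F ⟧M ⟧C ⊸ G             ≈⟨ ⊸-cong (trans dn (⟦⟧C∘⟦⟧M F)) refl ⟩
    F ⊸ G                            ∎
  ⟦⟧C∘⟦⟧M ⊥        = refl
  ⟦⟧C∘⟦⟧M (F & G)  = &-cong (⟦⟧C∘⟦⟧M F) (⟦⟧C∘⟦⟧M G)
  ⟦⟧C∘⟦⟧M ⊤        = refl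

  ⟦⟧C-resp-=E : ∀ {A B} → A =E B → ⟦ A ⟧C =D ⟦ B ⟧C
  ⟦⟧C-resp-=E refl         = refl
  ⟦⟧C-resp-=E (sym p)      = sym (⟦⟧C-resp-=E p)
  ⟦⟧C-resp-=E (trans p q)  = trans (⟦⟧C-resp-=E p) (⟦⟧C-resp-=E q)
  ⟦⟧C-resp-=E (⊗-cong p q) = ⊗-cong (⟦⟧C-resp-=E p) (⟦⟧C-resp-=E q)
  ⟦⟧C-resp-=E (⅋-cong p q) = ⅋ᶜ-cong (⟦⟧C-resp-=E p) (⟦⟧C-resp-=E q)
  ⟦⟧C-resp-=E (&-cong p q) = &-cong (⟦⟧C-resp-=E p) (⟦⟧C-resp-=E q)
  ⟦⟧C-resp-=E (⊕-cong p q) = ⊕ᶜ-cong (⟦⟧C-resp-=E p) (⟦⟧C-resp-=E q)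
  ⟦⟧C-resp-=E ⊗-assoc      = ⊗-assoc
  ⟦⟧C-resp-=E ⊗-comm       = ⊗-comm
  ⟦⟧C-resp-=E ⅋-assoc      = ⅋ᶜ-assoc
  ⟦⟧C-resp-=E ⅋-comm       = ⅋ᶜ-comm
  ⟦⟧C-resp-=E ⊕-assoc      = ⊕ᶜ-assoc
  ⟦⟧C-resp-=E ⊕-comm       = ⊕ᶜ-comm
  ⟦⟧C-resp-=E &-assoc      = &-assoc
  ⟦⟧C-resp-=E &-comm       = &-comm
  ⟦⟧C-resp-=E ⊗-⊕          = ⊗-distrib-⊕ᶜ
  ⟦⟧C-resp-=E ⅋-&          = ⅋ᶜ-distrib-&
  ⟦⟧C-resp-=E ⊗-unit       = ⊗-unit
  ⟦⟧C-resp-=E ⅋-unit       = ⅋ᶜ-unit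
  ⟦⟧C-resp-=E ⊕-unit       = ⊕ᶜ-unit
  ⟦⟧C-resp-=E &-unit       = &-unit
  ⟦⟧C-resp-=E ⊗-zero       = ⊗-¬⊤
  ⟦⟧C-resp-=E ⅋-top        = ⅋ᶜ-top

lemma9p1 : (Atom : Set) → let open Defs.Formulas Atom in
    (∀ (A : MALL) → ⟦ A ^⊥ ⟧C =D ⟦ A ⟧C ⊸ ⊥)
    × (∀ (F : Cat) → ⟦ ⟦ F ⟧M ⟧C =D F)
    × (∀ (A B : MALL) → A =E B → ⟦ A ⟧C =D ⟦ B ⟧C)
lemma9p1 Atom = ⟦⟧C-^⊥ Atom , ⟦⟧C∘⟦⟧M Atom , λ _ _ → ⟦⟧C-resp-=E Atom
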